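{- Let $G=(V,E)$ be a connected word-representable graph and let $w=uXXv$ be a word representing $G$, where $u,v$ are (possibly empty) words and $XX$ is a non-trivial square. If $x,y\in V$ are adjacent in $G$, then the number of occurrences of $x$ in $X$ equals the number of occurrences of $y$ in $X$.
   Context: A word $w$ over the alphabet $V$ represents the simple graph $G=(V,E)$ if every letter of $V$ occurs in $w$ and, for all distinct $x,y\in V$, the letters $x$ and $y$ alternate in $w$ (i.e. deleting all other letters from $w$ leaves a word of the form $xyxy\cdots$ or $yxyx\cdots$) if and only if $xy\in E$. A square is a factor $XX$ with $X$ non-empty; it is non-trivial if $X$ has length at least $2$. -}

module Defs where

open import Data.Nat using (ℕ; _≥_)
open import Data.Fin using (Fin)
open import Data.Fin.Properties using (_≟_)
open import Data.Bool using (Bool; true; false; T)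
open import Data.List using (List; []; _∷_; _++_; length; filter)
open import Data.Unit using (⊤)
open import Data.List.Membership.Propositional using (_∈_)
open import Data.Product using (Σ; _×_; ∃; _,_)
open import Data.Sum using (_⊎_)
open import Relation.Binary.PropositionalEquality using (_≡_)
open import Relation.Nullary using (¬_)
open import Relation.Nullary.Decidable using (_⊎-dec_)
open import Function.Bundles using (_⇔_)

record Graph (n : ℕ) : Set where
  field
    adj       : Fin n → Fin n → Bool
    adj-sym   : ∀ x y → adj x y ≡ adj y x
    adj-irref : ∀ x → adj x x ≡ false

open Graph public

Edge : ∀ {n} → Graph n → Fin n → Fin n → Set
Edge G x y = T (adj G x y)

data Path {n : ℕ} (G : Graph n) : Fin n → Fin n → Set where
  here : ∀ {x} → Path G x x
  step : ∀ {x y z} → Edge G x y → Path G y z → Path G x z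

Connected : ∀ {n} → Graph n → Set
Connected {n} G = ∀ (x y : Fin n) → Path G x y

Word : ℕ → Set
Word n = List (Fin n)

restrict : ∀ {n} → Fin n → Fin n → Word n → Word n
restrict x y w = filter (λ z → (z ≟ x) ⊎-dec (z ≟ y)) w

NoRepeat : ∀ {n} → Word n → Set
NoRepeat []            = ⊤
NoRepeat (a ∷ [])      = ⊤
NoRepeat (a ∷ b ∷ w)   = ¬ (a ≡ b) × NoRepeat (b ∷ w)

-- x and y alternate in w: deleting all other letters leaves xyxy... or yxyx...
Alternate : ∀ {n} → Fin n → Fin n → Word n → Set
Alternate x y w = NoRepeat (restrict x y w)

Represents : ∀ {n} → Word n → Graph n → Set
Represents {n} w G =
  (∀ (x : Fin n) → x ∈ w) ×
  (∀ (x y : Fin n) → ¬ (x ≡ y) → (Alternate x y w ⇔ Edge G x y))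

WordRepresentable : ∀ {n} → Graph n → Set
WordRepresentable {n} G = ∃ λ (w : Word n) → Represents w G

occ : ∀ {n} → Fin n → Word n → ℕ
occ x X = length (filter (_≟ x) X)

-- Restricted to the letters x and y, the square XX becomes a square r r of a word r over {x, y},
-- and it still alternates because x and y are adjacent. An alternating word is balanced exactly
-- when its last letter differs from its first; in r r the last letter of r is followed by the
-- first letter of r, so r is balanced.
module Submission where

open import Defs
open import Data.Nat using (ℕ; _≥_; suc)
open import Data.Fin using (Fin)
open import Data.Fin.Properties using (_≟_)
open import Data.List using ([]; _∷_; _++_; length; filter)
open import Data.List.Properties using (filter-++; filter-accept; filter-reject; ++-assoc)
open import Data.List.Relation.Unary.All as All using (All; _∷_)
open import Data.List.Relation.Unary.All.Properties using (all-filter)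
open import Data.Bool using (false)
open import Data.Empty using (⊥-elim)
open import Data.Product using (_,_; proj₁; proj₂)
open import Data.Sum as Sum using (_⊎_; inj₁; inj₂)
open import Relation.Nullary using (¬_; Dec; yes; no; _⊎-dec_)
open import Relation.Binary.PropositionalEquality
open import Function.Bundles using (Equivalence)

Edge⇒≢ : ∀ {n} (G : Graph n) {x y : Fin n} → Edge G x y → ¬ x ≡ y
Edge⇒≢ G {x} e refl with adj G x x | adj-irref G x
... | .false | refl = e

module _ {n : ℕ} where

  occ-∷-≡ : (a : Fin n) (t : Word n) → occ a (a ∷ t) ≡ suc (occ a t)
  occ-∷-≡ a t = cong length (filter-accept (_≟ a) refl)

  occ-∷-≢ : {a c : Fin n} (t : Word n) → ¬ c ≡ a → occ a (c ∷ t) ≡ occ a t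
  occ-∷-≢ {a} t c≢a = cong length (filter-reject (_≟ a) c≢a)

  occ-filter : ∀ {p} {P : Fin n → Set p} (P? : ∀ z → Dec (P z)) {x : Fin n} →
               P x → (X : Word n) → occ x (filter P? X) ≡ occ x X
  occ-filter P? Px [] = refl
  occ-filter P? {x} Px (z ∷ X) with P? z
  ... | yes _ with z ≟ x
  ...   | yes _ = cong suc (occ-filter P? Px X)
  ...   | no  _ = occ-filter P? Px X
  occ-filter P? {x} Px (z ∷ X) | no ¬Pz =
    trans (occ-filter P? Px X) (sym (occ-∷-≢ {c = z} X λ { refl → ¬Pz Px }))

  NoRepeat-++ʳ : (p q : Word n) → NoRepeat (p ++ q) → NoRepeat q
  NoRepeat-++ʳ []          q nr       = nr
  NoRepeat-++ʳ (a ∷ [])    []      _  = _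
  NoRepeat-++ʳ (a ∷ [])    (b ∷ q) nr = proj₂ nr
  NoRepeat-++ʳ (a ∷ b ∷ p) q       nr = NoRepeat-++ʳ (b ∷ p) q (proj₂ nr)

  OnLetters : Fin n → Fin n → Word n → Set
  OnLetters a b = All (λ z → z ≡ a ⊎ z ≡ b)

  mutual
    alternating-balanced : {a b : Fin n} (s t : Word n) → ¬ a ≡ b → OnLetters a b s →
                           NoRepeat ((a ∷ s) ++ a ∷ t) → occ a (a ∷ s) ≡ occ b (a ∷ s)
    alternating-balanced []      t a≢b _               nr = ⊥-elim (proj₁ nr refl)
    alternating-balanced (c ∷ s) t a≢b (inj₁ refl ∷ _) nr = ⊥-elim (proj₁ nr refl)
    alternating-balanced {a} {b} (c ∷ s) t a≢b (inj₂ refl ∷ on) nr = begin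
      occ a (a ∷ b ∷ s)   ≡⟨ occ-∷-≡ a (b ∷ s) ⟩
      suc (occ a (b ∷ s)) ≡⟨ sym (alternating-surplus s t (≢-sym a≢b)
                                    (All.map Sum.swap on) (proj₂ nr)) ⟩
      occ b (b ∷ s)       ≡⟨ sym (occ-∷-≢ (b ∷ s) a≢b) ⟩
      occ b (a ∷ b ∷ s)   ∎
      where open ≡-Reasoning

    alternating-surplus : {a b : Fin n} (s t : Word n) → ¬ a ≡ b → OnLetters a b s →
                          NoRepeat ((a ∷ s) ++ b ∷ t) → occ a (a ∷ s) ≡ suc (occ b (a ∷ s))
    alternating-surplus {a} {b} [] t a≢b _ _ =
      trans (occ-∷-≡ a []) (cong suc (sym (occ-∷-≢ [] a≢b)))
    alternating-surplus (c ∷ s) t a≢b (inj₁ refl ∷ _) nr = ⊥-elim (proj₁ nr refl)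
    alternating-surplus {a} {b} (c ∷ s) t a≢b (inj₂ refl ∷ on) nr = begin
      occ a (a ∷ b ∷ s)         ≡⟨ occ-∷-≡ a (b ∷ s) ⟩
      suc (occ a (b ∷ s))       ≡⟨ cong suc (sym (alternating-balanced s t (≢-sym a≢b)
                                                     (All.map Sum.swap on) (proj₂ nr))) ⟩
      suc (occ b (b ∷ s))       ≡⟨ cong suc (sym (occ-∷-≢ (b ∷ s) a≢b)) ⟩
      suc (occ b (a ∷ b ∷ s))   ∎
      where open ≡-Reasoning

  square-balanced : {x y : Fin n} (r t : Word n) → ¬ x ≡ y → OnLetters x y r →
                    NoRepeat (r ++ r ++ t) → occ x r ≡ occ y r
  square-balanced []      t x≢y _                nr = refl
  square-balanced (a ∷ s) t x≢y (inj₁ refl ∷ on) nr =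
    alternating-balanced s (s ++ t) x≢y on nr
  square-balanced (a ∷ s) t x≢y (inj₂ refl ∷ on) nr =
    sym (alternating-balanced s (s ++ t) (≢-sym x≢y) (All.map Sum.swap on) nr)

  restrict-square : (x y : Fin n) (u X v : Word n) →
                    restrict x y (u ++ (X ++ X) ++ v) ≡
                    restrict x y u ++ restrict x y X ++ restrict x y X ++ restrict x y v
  restrict-square x y u X v = begin
    F (u ++ (X ++ X) ++ v)            ≡⟨ filter-++ P? u _ ⟩
    F u ++ F ((X ++ X) ++ v)          ≡⟨ cong (F u ++_) (filter-++ P? (X ++ X) v) ⟩
    F u ++ F (X ++ X) ++ F v          ≡⟨ cong (λ m → F u ++ m ++ F v) (filter-++ P? X X) ⟩
    F u ++ (F X ++ F X) ++ F v        ≡⟨ cong (F u ++_) (++-assoc (F X) (F X) (F v)) ⟩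
    F u ++ F X ++ F X ++ F v          ∎
    where
      open ≡-Reasoning
      P? : (z : Fin n) → Dec (z ≡ x ⊎ z ≡ y)
      P? z = (z ≟ x) ⊎-dec (z ≟ y)
      F : Word n → Word n
      F = restrict x y

mainTheorem2 : ∀ {n : ℕ} (G : Graph n) → Connected G → WordRepresentable G →
    ∀ (w u X v : Word n) → Represents w G →
    w ≡ u ++ (X ++ X) ++ v → length X ≥ 2 →
    ∀ (x y : Fin n) → Edge G x y → occ x X ≡ occ y X
mainTheorem2 {n} G _ _ w u X v (_ , represents) refl _ x y xy = begin
  occ x X  ≡⟨ sym (occ-filter P? (inj₁ refl) X) ⟩
  occ x r  ≡⟨ square-balanced r (restrict x y v) x≢y (all-filter P? X) rr-alternates ⟩
  occ y r  ≡⟨ occ-filter P? (inj₂ refl) X ⟩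
  occ y X  ∎
  where
    open ≡-Reasoning
    P? : (z : Fin n) → Dec (z ≡ x ⊎ z ≡ y)
    P? z = (z ≟ x) ⊎-dec (z ≟ y)
    r : Word n
    r = restrict x y X
    x≢y : ¬ x ≡ y
    x≢y = Edge⇒≢ G xy
    rr-alternates : NoRepeat (r ++ r ++ restrict x y v)
    rr-alternates = NoRepeat-++ʳ (restrict x y u) _
      (subst NoRepeat (restrict-square x y u X v) (Equivalence.from (represents x y x≢y) xy))
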